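{- Let $a\in\{0,1\}$, $j,k\ge1$, $w=a^j\overline{a}^k$, and $u\in\{0,1\}^k$ with $u\neq0^k$. Then there exists a word in $\mathcal{O}_w(0^ju)$ having prefix $10^{j-1}$.
   Context: For words $w=w_1\cdots w_\ell$, $u=u_1\cdots u_\ell$ over $\{0,1\}$ and $a\in\{0,1\}$, $S_a(w)(u)\in\{0,1\}^\ell$ is the word with $\ell$-th letter $u_\ell$ and $i$-th letter $u_i\oplus(u_{i+1}\wedge[w_{i+1}=a])$ for $1\le i\le\ell-1$ ($[\cdot]$ the indicator; $\oplus,\wedge$ XOR/AND). For $h=h_1\cdots h_r\in\{0,1\}^*$, $S_h(w)=S_{h_1}(w)\circ\cdots\circ S_{h_r}(w)$ ($S_\varepsilon(w)$ the identity), and $\mathcal{O}_w(u)=\{S_h(w)(u):h\in\{0,1\}^*\}$. $\overline{0}=1$, $\overline{1}=0$; $x^k$ is $k$-fold concatenation. -}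

module Defs where

open import Data.Bool using (Bool; true; false; _xor_; _∧_; not)
open import Data.Bool.Properties using () renaming (_≟_ to _≟ᵇ_)
open import Data.Nat using (ℕ; zero; suc; _+_)
open import Data.List using (List; []; _∷_)
open import Data.Vec using (Vec; []; _∷_; replicate; _++_)
open import Data.Product using (∃; ∃-syntax; _×_)
open import Relation.Binary.PropositionalEquality using (_≡_)
open import Relation.Nullary.Decidable using (⌊_⌋)

-- letters of {0,1} are Booleans: 0 = false, 1 = true

_==ᵇ_ : Bool → Bool → Bool
x ==ᵇ a = ⌊ x ≟ᵇ a ⌋

S : ∀ {ℓ} → Bool → Vec Bool ℓ → Vec Bool ℓ → Vec Bool ℓ
S a [] [] = []
S a (w₀ ∷ []) (u₀ ∷ []) = u₀ ∷ []
S a (w₀ ∷ w₁ ∷ ws) (u₀ ∷ u₁ ∷ us) =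
  (u₀ xor (u₁ ∧ (w₁ ==ᵇ a))) ∷ S a (w₁ ∷ ws) (u₁ ∷ us)

Sh : ∀ {ℓ} → List Bool → Vec Bool ℓ → Vec Bool ℓ → Vec Bool ℓ
Sh [] w u = u
Sh (h ∷ hs) w u = S h w (Sh hs w u)

_∈Orbit[_,_] : ∀ {ℓ} → Vec Bool ℓ → Vec Bool ℓ → Vec Bool ℓ → Set
v ∈Orbit[ w , u ] = ∃[ h ] (v ≡ Sh h w u)

HasPrefix : ∀ {m n} → Vec Bool (m + n) → Vec Bool m → Set
HasPrefix {m} {n} v p = ∃[ s ] (v ≡ p ++ s)

{-# OPTIONS --safe #-}
-- Over w = aʲ⁺¹ (¬a)ᵏ⁺¹ the first j + 1 letters form a block that can be driven to any value
-- while the remaining letters stay nonzero.  The tail evolves on its own, and a nonzero tail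
-- can feed either parity into the last block letter, which settles blocks of length one.  For
-- longer blocks, first drive the rest of the block to 1 0…0: then S_a flips the first letter and
-- fixes everything else (it acts trivially on the (¬a)-tail), so the first letter can be preset
-- to whatever makes it come out right once the rest of the block is driven to its target.
module Submission where

open import Defs
open import Data.Bool using (Bool; true; false; not; _xor_; _∧_)
open import Data.Bool.Properties
  using (xor-identityʳ; xor-assoc; xor-comm; ∧-zeroʳ; not-involutive; ¬-not) renaming (_≟_ to _≟ᵇ_)
open import Data.Nat using (ℕ; zero; suc; _+_)
open import Data.List using (List; []; _∷_; [_]) renaming (_++_ to _++ˡ_)
open import Data.Vec using (Vec; []; _∷_; replicate; _++_; head)
open import Data.Vec.Properties using (∷-injectiveˡ; ∷-injectiveʳ)
open import Data.Product using (∃-syntax; _×_; _,_; proj₂)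
open import Relation.Binary.PropositionalEquality
  using (_≡_; _≢_; refl; sym; trans; cong; cong₂; module ≡-Reasoning)
open import Function using (_∘_)
open import Relation.Nullary using (¬_; yes; no; contradiction)

private
  variable
    n : ℕ

xor-cancelˡ : ∀ x y → x xor (x xor y) ≡ y
xor-cancelˡ false y = refl
xor-cancelˡ true  y = not-involutive y

==ᵇ-refl : ∀ c → (c ==ᵇ c) ≡ true
==ᵇ-refl true  = refl
==ᵇ-refl false = refl

xor-∧-not-==ᵇ : ∀ a x y → x xor (y ∧ (not a ==ᵇ a)) ≡ x
xor-∧-not-==ᵇ true  x y rewrite ∧-zeroʳ y = xor-identityʳ x
xor-∧-not-==ᵇ false x y rewrite ∧-zeroʳ y = xor-identityʳ x

Sh-++ : ∀ h₁ h₂ (w u : Vec Bool n) → Sh (h₁ ++ˡ h₂) w u ≡ Sh h₁ w (Sh h₂ w u)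
Sh-++ []       h₂ w u = refl
Sh-++ (b ∷ h₁) h₂ w u = cong (S b w) (Sh-++ h₁ h₂ w u)

∈Orbit-trans : {w u v z : Vec Bool n} → v ∈Orbit[ w , u ] → z ∈Orbit[ w , v ] → z ∈Orbit[ w , u ]
∈Orbit-trans {w = w} {u} (h₁ , refl) (h₂ , refl) = h₂ ++ˡ h₁ , sym (Sh-++ h₂ h₁ w u)

S-≡0 : ∀ b (w u : Vec Bool n) → S b w u ≡ replicate n false → u ≡ replicate n false
S-≡0 b []           []            eq = refl
S-≡0 b (_ ∷ [])     (u₀ ∷ [])      eq = eq
S-≡0 b (_ ∷ w₁ ∷ w) (u₀ ∷ u₁ ∷ u) eq with S-≡0 b (w₁ ∷ w) (u₁ ∷ u) (∷-injectiveʳ eq)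
... | refl = cong (_∷ _) (trans (sym (xor-identityʳ u₀)) (∷-injectiveˡ eq))

∈Orbit-≢0 : {w u v : Vec Bool n} → v ∈Orbit[ w , u ] → u ≢ replicate n false → v ≢ replicate n false
∈Orbit-≢0         ([]    , refl) u≢0 = u≢0
∈Orbit-≢0 {w = w} (b ∷ h , refl) u≢0 = ∈Orbit-≢0 (h , refl) u≢0 ∘ S-≡0 b w _

-- Parity of the number of times the letter in front of w gets flipped along h.
toggled : List Bool → Vec Bool (suc n) → Vec Bool (suc n) → Bool
toggled []      w y = false
toggled (b ∷ h) w y = toggled h w y xor (head (Sh h w y) ∧ (head w ==ᵇ b))

Sh-∷ : ∀ h c x (w y : Vec Bool (suc n)) → Sh h (c ∷ w) (x ∷ y) ≡ (x xor toggled h w y) ∷ Sh h w y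
Sh-∷ []      c x w y = cong (_∷ y) (sym (xor-identityʳ x))
Sh-∷ (b ∷ h) c x w@(w₁ ∷ _) y rewrite Sh-∷ h c x w y with Sh h w y
... | v₁ ∷ v = cong (_∷ S b w (v₁ ∷ v)) (xor-assoc x (toggled h w y) (v₁ ∧ (w₁ ==ᵇ b)))

∈Orbit-∷ : ∀ c {w y v : Vec Bool (suc n)} → v ∈Orbit[ w , y ] →
           ∃[ d ] ∀ x → ((x xor d) ∷ v) ∈Orbit[ c ∷ w , x ∷ y ]
∈Orbit-∷ c {w} {y} (h , refl) = toggled h w y , λ x → h , sym (Sh-∷ h c x w y)

∈Orbit-∷-fromSomeHead : ∀ c {w y v : Vec Bool (suc n)} → v ∈Orbit[ w , y ] →
                   ∀ t → ∃[ x ] (t ∷ v) ∈Orbit[ c ∷ w , x ∷ y ]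
∈Orbit-∷-fromSomeHead c o t with ∈Orbit-∷ c o
... | d , lift with lift (d xor t)
...   | o′ rewrite xor-comm (d xor t) d | xor-cancelˡ d t = d xor t , o′

mutual
  head-true : (w y : Vec Bool (suc n)) → y ≢ replicate (suc n) false → ∃[ h ] head (Sh h w y) ≡ true
  head-true w            (true ∷ y)     y≢0 = [] , refl
  head-true (c ∷ [])     (false ∷ [])   y≢0 = contradiction refl y≢0
  head-true (c ∷ w₁ ∷ w) (false ∷ y₁ ∷ y) y≢0 with toggled-true (w₁ ∷ w) (y₁ ∷ y) (y≢0 ∘ cong (false ∷_))
  ... | h , toggled≡true = h , trans (cong head (Sh-∷ h c false (w₁ ∷ w) (y₁ ∷ y))) toggled≡true

  -- If the head does not flip along an h making the head of y true, one more step at letter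
  -- head w flips it.
  toggled-true : (w y : Vec Bool (suc n)) → y ≢ replicate (suc n) false → ∃[ h ] toggled h w y ≡ true
  toggled-true w y y≢0 with head-true w y y≢0
  ... | h , head≡true with toggled h w y in toggled≡
  ...   | true  = h , toggled≡
  ...   | false = head w ∷ h , flipped
    where
    flipped : toggled (head w ∷ h) w y ≡ true
    flipped rewrite toggled≡ | head≡true | ==ᵇ-refl (head w) = refl

head-settable : ∀ c (w y : Vec Bool (suc n)) → y ≢ replicate (suc n) false → ∀ x t →
                ∃[ s ] (t ∷ s) ∈Orbit[ c ∷ w , x ∷ y ] × s ≢ replicate (suc n) false
head-settable c w y y≢0 x t with x ≟ᵇ t
... | yes refl = y , ([] , refl) , y≢0
... | no x≢t with toggled-true w y y≢0
...   | h , toggled≡true = Sh h w y , (h , sym reach) , ∈Orbit-≢0 (h , refl) y≢0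
  where
  open ≡-Reasoning
  reach : Sh h (c ∷ w) (x ∷ y) ≡ t ∷ Sh h w y
  reach = begin
    Sh h (c ∷ w) (x ∷ y)            ≡⟨ Sh-∷ h c x w y ⟩
    (x xor toggled h w y) ∷ Sh h w y ≡⟨ cong (λ d → (x xor d) ∷ Sh h w y) toggled≡true ⟩
    (x xor true) ∷ Sh h w y          ≡⟨ cong (_∷ Sh h w y) (xor-comm x true) ⟩
    not x ∷ Sh h w y                 ≡⟨ cong (_∷ Sh h w y) (sym (¬-not (x≢t ∘ sym))) ⟩
    t ∷ Sh h w y                     ∎

∈Orbit-everyHead : ∀ {w u : Vec Bool (suc n)} {v : Vec Bool n} → (∀ c → (not c ∷ v) ∈Orbit[ w , c ∷ v ]) →
           ∀ {b} → (b ∷ v) ∈Orbit[ w , u ] → ∀ c → (c ∷ v) ∈Orbit[ w , u ]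
∈Orbit-everyHead flipHead {b} o c with c ≟ᵇ b
... | yes refl = o
... | no c≢b rewrite ¬-not c≢b = ∈Orbit-trans o (flipHead b)

module Block (a : Bool) (k : ℕ) where

  tailWord : Vec Bool (suc k)
  tailWord = replicate (suc k) (not a)

  word : ∀ j → Vec Bool (suc j + suc k)
  word j = replicate (suc j) a ++ tailWord

  unit : ∀ j → Vec Bool (suc j)
  unit j = true ∷ replicate j false

  S-fixes-tailWord : ∀ m (s : Vec Bool m) → S a (replicate m (not a)) s ≡ s
  S-fixes-tailWord zero          []           = refl
  S-fixes-tailWord (suc zero)    (s₀ ∷ [])     = refl
  S-fixes-tailWord (suc (suc m)) (s₀ ∷ s₁ ∷ s) =
    cong₂ _∷_ (xor-∧-not-==ᵇ a s₀ s₁) (S-fixes-tailWord (suc m) (s₁ ∷ s))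

  S-fixes-∷zeros : ∀ j c (s : Vec Bool (suc k)) →
                   S a (word j) (c ∷ replicate j false ++ s) ≡ c ∷ replicate j false ++ s
  S-fixes-∷zeros zero    c (s₀ ∷ s) = cong₂ _∷_ (xor-∧-not-==ᵇ a c s₀) (S-fixes-tailWord (suc k) (s₀ ∷ s))
  S-fixes-∷zeros (suc j) c s        = cong₂ _∷_ (xor-identityʳ c) (S-fixes-∷zeros j false s)

  S-flips-∷unit : ∀ j c (s : Vec Bool (suc k)) →
                  S a (word (suc j)) (c ∷ unit j ++ s) ≡ not c ∷ unit j ++ s
  S-flips-∷unit j c s rewrite S-fixes-∷zeros j true s | ==ᵇ-refl a = cong (_∷ unit j ++ s) (xor-comm c true)

  block-settable : ∀ j (x t : Vec Bool (suc j)) (y : Vec Bool (suc k)) → y ≢ replicate (suc k) false →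
                   ∃[ s ] (t ++ s) ∈Orbit[ word j , x ++ y ] × s ≢ replicate (suc k) false
  block-settable zero    (x ∷ [])  (t ∷ [])  y y≢0 = head-settable a tailWord y y≢0 x t
  block-settable (suc j) (x ∷ xs) (t ∷ ts) y y≢0 with block-settable j xs (unit j) y y≢0
  ... | s₁ , o₁ , s₁≢0 with block-settable j (unit j) ts s₁ s₁≢0
  ...   | s₂ , o₂ , s₂≢0 with ∈Orbit-∷-fromSomeHead a o₂ t
  ...     | c , o₃ = s₂ , ∈Orbit-trans (anyHead c) o₃ , s₂≢0
    where
    anyHead : ∀ c → (c ∷ unit j ++ s₁) ∈Orbit[ word (suc j) , x ∷ xs ++ y ]
    anyHead = ∈Orbit-everyHead (λ c → [ a ] , sym (S-flips-∷unit j c s₁)) (proj₂ (∈Orbit-∷ a o₁) x)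

lemma7p10 : (a : Bool) (j k : ℕ) (u : Vec Bool (suc k)) →
    ¬ (u ≡ replicate (suc k) false) →
    ∃[ v ] (v ∈Orbit[ replicate (suc j) a ++ replicate (suc k) (not a) , replicate (suc j) false ++ u ]
            × HasPrefix {suc j} {suc k} v (true ∷ replicate j false))
lemma7p10 a j k u u≢0 =
  let s , o , _ = Block.block-settable a k j (replicate (suc j) false) (Block.unit a k j) u u≢0
  in Block.unit a k j ++ s , o , s , refl
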